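{- For each $\mathsf{SCI}$-formula $\varphi$, every branch of a $\mathsf{TC}_{\mathsf{SCI}}$-tableau for $\varphi$ (a tableau whose root is $w:\varphi$ for some label $w$) is of polynomial size with respect to the size $|\varphi|$ of $\varphi$.
   Context: Logic SCI. Fix a countably infinite set $\mathsf{AF}$ of atomic formulas. The set $\mathsf{FOR}$ of SCI-formulas is given by $\varphi ::= p \mid \neg\varphi \mid \varphi\to\varphi \mid \varphi\equiv\varphi$ with $p\in\mathsf{AF}$. The size $|\varphi|$ is the number of all occurrences of subformulas of $\varphi$. Tableau system $\mathsf{TC}_{\mathsf{SCI}}$. Let $\mathsf{L}^+,\mathsf{L}^-$ be disjoint countably infinite sets of labels, $\mathsf{L}=\mathsf{L}^+\cup\mathsf{L}^-$; a label written $w^+$ lies in $\mathsf{L}^+$, $w^-$ in $\mathsf{L}^-$, an unsuperscripted label is arbitrary. A labelled formula is $w:\varphi$ with $w\in\mathsf{L},\varphi\in\mathsf{FOR}$. Equality statements $w=v$ and inequality statements $w\neq v$ may also occur. A tableau is a tree whose nodes carry labelled formulas, (in)equality statements or $\bot$; a branch is a root-to-leaf path, identified with the set of items on it. Rules (premises / alternative conclusion sets separated by $\mid$): Decomposition rules (all labels in the conclusions are fresh on the branch): $(\neg^+)$ $w^+:\neg\varphi$ / $v^-:\varphi$; $(\neg^-)$ $w^-:\neg\varphi$ / $v^+:\varphi$; $(\to^+)$ $w^+:\varphi\to\psi$ / $\{v^-:\varphi,u^-:\psi\}\mid\{v^-:\varphi,u^+:\psi\}\mid\{v^+:\varphi,u^+:\psi\}$;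 $(\to^-)$ $w^-:\varphi\to\psi$ / $\{v^+:\varphi,u^-:\psi\}$; $(\equiv^+)$ $w^+:\varphi\equiv\psi$ / $\{v^+:\varphi,u^+:\psi,v^+=u^+\}\mid\{v^-:\varphi,u^-:\psi,v^-=u^-\}$; $(\equiv^-)$ $w^-:\varphi\equiv\psi$ / $\{v^+:\varphi,u^+:\psi,v^+\neq u^+\}\mid\{v^+:\varphi,u^-:\psi\}\mid\{v^-:\varphi,u^+:\psi\}\mid\{v^-:\varphi,u^-:\psi,v^-\neq u^-\}$. Equality rules, where $\varphi\approx\psi$ abbreviates the three premises $w:\varphi$, $v:\psi$, $w=v$ for some labels $w,v$: $(\equiv^\neg)$ $\varphi\approx\psi$, $u:\neg\varphi$, $y:\neg\psi$ / $u=y$; $(\equiv^\to)$ $\varphi\approx\psi$, $\chi\approx\theta$, $x:\varphi\to\chi$, $z:\psi\to\theta$ / $x=z$; $(\equiv^\equiv)$ $\varphi\approx\psi$, $\chi\approx\theta$, $x:\varphi\equiv\chi$, $z:\psi\equiv\theta$ / $x=z$; $(\mathsf F)$ $w:\varphi$, $v:\varphi$ / $w=v$; $(\mathsf{sym})$ $w=v$ / $v=w$; $(\mathsf{tran})$ $w=v$, $v=u$ / $w=u$. Closure rules: $(\bot_1)$ $w=v$, $w\neq v$ / $\bot$; $(\bot_2)$ $w^+=v^-$ / $\bot$. Applicability restrictions: a decomposition rule may be applied to $w:\varphi$ on a branch only if it has not been applied to $w:\varphi$ on that branch before; an equality rule may be applied to premises on a branch only if its conclusion is not already on that branch; closure rules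 are applied eagerly, and a branch on which a closure rule has been applied is not extended further. -}

module Defs where

open import Data.Nat using (ℕ; _+_; _*_; suc)
open import Data.List using (List; []; _∷_; _++_)
open import Data.List.Membership.Propositional using (_∈_; _∉_)
open import Data.List.Relation.Unary.All using (All)
open import Data.List.Relation.Unary.Unique.Propositional using (Unique)
open import Data.Product using (Σ; _×_; _,_)
open import Data.Sum using (_⊎_)
open import Relation.Nullary using (¬_)

data Fml : Set where
  atom : ℕ → Fml
  ¬'_  : Fml → Fml
  _⇒_  : Fml → Fml → Fml
  _≡'_ : Fml → Fml → Fml

size : Fml → ℕ
size (atom p) = 1
size (¬' φ)   = suc (size φ)
size (φ ⇒ ψ)  = suc (size φ + size ψ)
size (φ ≡' ψ) = suc (size φ + size ψ)

-- Labels: L⁺ = {pos n}, L⁻ = {neg n}, disjoint and countably infinite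

data Label : Set where
  pos : ℕ → Label
  neg : ℕ → Label

-- Items that may label tableau nodes
data Item : Set where
  lab : Label → Fml → Item
  eq  : Label → Label → Item
  neq : Label → Label → Item
  bot : Item

data OccursIn (l : Label) : Item → Set where
  in-lab  : ∀ {φ} → OccursIn l (lab l φ)
  in-eqˡ  : ∀ {v} → OccursIn l (eq l v)
  in-eqʳ  : ∀ {w} → OccursIn l (eq w l)
  in-neqˡ : ∀ {v} → OccursIn l (neq l v)
  in-neqʳ : ∀ {w} → OccursIn l (neq w l)

FreshOn : List Item → Label → Set
FreshOn B l = ∀ {it} → it ∈ B → ¬ OccursIn l it

-- Decomposition rules:  Dec w φ ls cs  means that the rule for w : φ
-- has the alternative conclusion set cs, whose labels are ls.

data Dec : Label → Fml → List Label → List Item → Set where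
  ¬⁺  : ∀ {i φ} v → Dec (pos i) (¬' φ) (neg v ∷ []) (lab (neg v) φ ∷ [])
  ¬⁻  : ∀ {i φ} v → Dec (neg i) (¬' φ) (pos v ∷ []) (lab (pos v) φ ∷ [])
  ⇒⁺₁ : ∀ {i φ ψ} v u → Dec (pos i) (φ ⇒ ψ) (neg v ∷ neg u ∷ [])
          (lab (neg v) φ ∷ lab (neg u) ψ ∷ [])
  ⇒⁺₂ : ∀ {i φ ψ} v u → Dec (pos i) (φ ⇒ ψ) (neg v ∷ pos u ∷ [])
          (lab (neg v) φ ∷ lab (pos u) ψ ∷ [])
  ⇒⁺₃ : ∀ {i φ ψ} v u → Dec (pos i) (φ ⇒ ψ) (pos v ∷ pos u ∷ [])
          (lab (pos v) φ ∷ lab (pos u) ψ ∷ [])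
  ⇒⁻  : ∀ {i φ ψ} v u → Dec (neg i) (φ ⇒ ψ) (pos v ∷ neg u ∷ [])
          (lab (pos v) φ ∷ lab (neg u) ψ ∷ [])
  ≡⁺₁ : ∀ {i φ ψ} v u → Dec (pos i) (φ ≡' ψ) (pos v ∷ pos u ∷ [])
          (lab (pos v) φ ∷ lab (pos u) ψ ∷ eq (pos v) (pos u) ∷ [])
  ≡⁺₂ : ∀ {i φ ψ} v u → Dec (pos i) (φ ≡' ψ) (neg v ∷ neg u ∷ [])
          (lab (neg v) φ ∷ lab (neg u) ψ ∷ eq (neg v) (neg u) ∷ [])
  ≡⁻₁ : ∀ {i φ ψ} v u → Dec (neg i) (φ ≡' ψ) (pos v ∷ pos u ∷ [])
          (lab (pos v) φ ∷ lab (pos u) ψ ∷ neq (pos v) (pos u) ∷ [])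
  ≡⁻₂ : ∀ {i φ ψ} v u → Dec (neg i) (φ ≡' ψ) (pos v ∷ neg u ∷ [])
          (lab (pos v) φ ∷ lab (neg u) ψ ∷ [])
  ≡⁻₃ : ∀ {i φ ψ} v u → Dec (neg i) (φ ≡' ψ) (neg v ∷ pos u ∷ [])
          (lab (neg v) φ ∷ lab (pos u) ψ ∷ [])
  ≡⁻₄ : ∀ {i φ ψ} v u → Dec (neg i) (φ ≡' ψ) (neg v ∷ neg u ∷ [])
          (lab (neg v) φ ∷ lab (neg u) ψ ∷ neq (neg v) (neg u) ∷ [])

_⊢_≈_ : List Item → Fml → Fml → Set
B ⊢ φ ≈ ψ = Σ Label λ w → Σ Label λ v →
  (lab w φ ∈ B) × (lab v ψ ∈ B) × (eq w v ∈ B)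

data EqConcl (B : List Item) : Item → Set where
  r≡¬ : ∀ {φ ψ u y} → B ⊢ φ ≈ ψ → lab u (¬' φ) ∈ B → lab y (¬' ψ) ∈ B →
        EqConcl B (eq u y)
  r≡⇒ : ∀ {φ ψ χ θ x z} → B ⊢ φ ≈ ψ → B ⊢ χ ≈ θ →
        lab x (φ ⇒ χ) ∈ B → lab z (ψ ⇒ θ) ∈ B → EqConcl B (eq x z)
  r≡≡ : ∀ {φ ψ χ θ x z} → B ⊢ φ ≈ ψ → B ⊢ χ ≈ θ →
        lab x (φ ≡' χ) ∈ B → lab z (ψ ≡' θ) ∈ B → EqConcl B (eq x z)
  rF  : ∀ {φ w v} → lab w φ ∈ B → lab v φ ∈ B → EqConcl B (eq w v)
  rsym  : ∀ {w v} → eq w v ∈ B → EqConcl B (eq v w)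
  rtran : ∀ {w v u} → eq w v ∈ B → eq v u ∈ B → EqConcl B (eq w u)

Closable : List Item → Set
Closable B =
  (Σ Label λ w → Σ Label λ v → (eq w v ∈ B) × (neq w v ∈ B))
  ⊎ (Σ ℕ λ i → Σ ℕ λ j → eq (pos i) (neg j) ∈ B)

-- Branch states: the items on the branch, together with the list of
-- labelled formulas to which a decomposition rule was already applied.

record State : Set where
  constructor ⟨_,_⟩
  field
    items : List Item
    done  : List (Label × Fml)

-- one rule application extending a branch (choosing one alternative)
data Step : State → State → Set where
  decomp : ∀ {B D w φ ls cs} →
    bot ∉ B → ¬ Closable B →
    lab w φ ∈ B → (w , φ) ∉ D →
    Dec w φ ls cs → All (FreshOn B) ls → Unique ls →
    Step ⟨ B , D ⟩ ⟨ cs ++ B , (w , φ) ∷ D ⟩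
  equality : ∀ {B D c} →
    bot ∉ B → ¬ Closable B →
    EqConcl B c → c ∉ B →
    Step ⟨ B , D ⟩ ⟨ c ∷ B , D ⟩
  closure : ∀ {B D} →
    bot ∉ B → Closable B →
    Step ⟨ B , D ⟩ ⟨ bot ∷ B , D ⟩

data Branch (φ : Fml) : State → Set where
  root : ∀ w → Branch φ ⟨ lab w φ ∷ [] , [] ⟩
  step : ∀ {S S′} → Branch φ S → Step S S′ → Branch φ S′

branchSize : State → ℕ
branchSize S = Data.List.length (State.items S)

-- polynomials with natural coefficients (a₀ ∷ a₁ ∷ …)

evalPoly : List ℕ → ℕ → ℕ
evalPoly []      n = 0
evalPoly (a ∷ p) n = a + n * evalPoly p n

{-# OPTIONS --safe #-}
-- Give every labelled formula w : ψ a potential 2|ψ| as long as no decomposition rule has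
-- been applied to it.  A decomposition rule spends the potential 2|φ| of its premise on at
-- most two new labelled formulas, each costing one node plus its own potential, and
-- 1 + 2|χ| ≤ 2|¬χ|, 2 + 2|χ| + 2|θ| = 2|χ ∘ θ|.  Hence a branch carries at most 2|φ| + 1
-- labelled formulas.  The remaining nodes are controlled by the labelled ones: equality
-- statements are pairwise distinct pairs of labels occurring on the branch, every
-- inequality statement comes with two new labelled formulas, and ⊥ occurs at most once.
-- So a branch has at most (L + 1)² ≤ (2|φ| + 2)² nodes, L the number of labelled formulas.
module Submission where

open import Defs
open import Data.Nat using (ℕ; suc; _+_; _*_; _≤_; z≤n; s≤s)
open import Data.Nat.Properties
open import Data.Nat.Tactic.RingSolver using (solve-∀)
open import Algebra.Properties.CommutativeSemigroup +-commutativeSemigroup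
  using (interchange; x∙yz≈y∙xz)
open import Data.List using (List; []; _∷_; _++_; length; map; cartesianProduct)
open import Data.List.Properties using (length-++; length-map; length-removeAt′)
open import Data.List.Membership.Propositional using (_∈_; _∉_)
open import Data.List.Membership.Propositional.Properties using (∈-++⁺ˡ; ∈-++⁺ʳ; ∈-++⁻; ∈-map⁺)
open import Data.List.Relation.Binary.Subset.Propositional using (_⊆_)
open import Data.List.Relation.Unary.Any as Any using (here; there; _─_; index)
open import Data.List.Relation.Unary.Any.Properties using (cartesianProduct⁺)
open import Data.List.Relation.Unary.All as All using (All; _∷_)
open import Data.List.Relation.Unary.All.Properties using (¬Any⇒All¬)
open import Data.List.Relation.Unary.AllPairs using ([]; _∷_)
open import Data.List.Relation.Unary.Unique.Propositional using (Unique)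
open import Data.Product as Product using (Σ; _×_; _,_; proj₁; proj₂)
open import Data.Sum using (inj₁; inj₂)
open import Function using (_∘_)
open import Relation.Nullary using (contradiction)
open import Relation.Binary.PropositionalEquality

module _ {A : Set} where

  ∈-─ : ∀ {x y : A} {ys} (x∈ys : x ∈ ys) → y ∈ ys → y ≢ x → y ∈ (ys ─ x∈ys)
  ∈-─ (here refl) (here refl) y≢x = contradiction refl y≢x
  ∈-─ (here refl) (there y∈ys) _  = y∈ys
  ∈-─ (there _)   (here refl) _   = here refl
  ∈-─ (there x∈ys) (there y∈ys) y≢x = there (∈-─ x∈ys y∈ys y≢x)

  unique∧⊆⇒length≤ : ∀ {xs ys : List A} → Unique xs → xs ⊆ ys → length xs ≤ length ys
  unique∧⊆⇒length≤ {[]} _ _ = z≤n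
  unique∧⊆⇒length≤ {x ∷ xs} {ys} (x∉xs ∷ unique) xxs⊆ys = begin
    suc (length xs)          ≤⟨ s≤s (unique∧⊆⇒length≤ unique xs⊆ys─x) ⟩
    suc (length (ys ─ x∈ys)) ≡⟨ length-removeAt′ ys (index x∈ys) ⟨
    length ys                ∎
    where
    open ≤-Reasoning
    x∈ys : x ∈ ys
    x∈ys = xxs⊆ys (here refl)
    xs⊆ys─x : xs ⊆ (ys ─ x∈ys)
    xs⊆ys─x y∈xs = ∈-─ x∈ys (xxs⊆ys (there y∈xs)) (All.lookup x∉xs y∈xs ∘ sym)

module _ {A B : Set} where

  length-cartesianProduct : ∀ (xs : List A) (ys : List B) →
    length (cartesianProduct xs ys) ≡ length xs * length ys
  length-cartesianProduct []       ys = refl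
  length-cartesianProduct (x ∷ xs) ys = begin
    length (map (x ,_) ys ++ cartesianProduct xs ys)    ≡⟨ length-++ (map (x ,_) ys) ⟩
    length (map (x ,_) ys) + length (cartesianProduct xs ys)
      ≡⟨ cong₂ _+_ (length-map (x ,_) ys) (length-cartesianProduct xs ys) ⟩
    length ys + length xs * length ys                    ∎
    where open ≡-Reasoning

  ∈-cartesianProduct⁺ : ∀ {x : A} {y : B} {xs ys} → x ∈ xs → y ∈ ys →
    (x , y) ∈ cartesianProduct xs ys
  ∈-cartesianProduct⁺ x∈xs y∈ys =
    Any.map (λ { (refl , refl) → refl }) (cartesianProduct⁺ x∈xs y∈ys)

labelled : List Item → List (Label × Fml)
labelled []            = []
labelled (lab w φ ∷ B) = (w , φ) ∷ labelled B
labelled (_ ∷ B)       = labelled B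

labels : List Item → List Label
labels B = map proj₁ (labelled B)

equalities : List Item → List (Label × Label)
equalities []           = []
equalities (eq w v ∷ B) = (w , v) ∷ equalities B
equalities (_ ∷ B)      = equalities B

count≠ : List Item → ℕ
count≠ []            = 0
count≠ (neq _ _ ∷ B) = suc (count≠ B)
count≠ (_ ∷ B)       = count≠ B

count⊥ : List Item → ℕ
count⊥ []        = 0
count⊥ (bot ∷ B) = suc (count⊥ B)
count⊥ (_ ∷ B)   = count⊥ B

length-by-kind : ∀ B →
  length B ≡ length (labelled B) + length (equalities B) + count≠ B + count⊥ B
length-by-kind []            = refl
length-by-kind (lab _ _ ∷ B) = cong suc (length-by-kind B)
length-by-kind (eq _ _ ∷ B)  = trans (cong suc (length-by-kind B))
  (cong (λ n → n + count≠ B + count⊥ B) (sym (+-suc _ (length (equalities B)))))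
length-by-kind (neq _ _ ∷ B) = trans (cong suc (length-by-kind B))
  (cong (_+ count⊥ B) (sym (+-suc _ (count≠ B))))
length-by-kind (bot ∷ B)     = trans (cong suc (length-by-kind B)) (sym (+-suc _ (count⊥ B)))

labelled-++ : ∀ cs B → labelled (cs ++ B) ≡ labelled cs ++ labelled B
labelled-++ []             B = refl
labelled-++ (lab w φ ∷ cs) B = cong ((w , φ) ∷_) (labelled-++ cs B)
labelled-++ (eq _ _ ∷ cs)  B = labelled-++ cs B
labelled-++ (neq _ _ ∷ cs) B = labelled-++ cs B
labelled-++ (bot ∷ cs)     B = labelled-++ cs B

∈-labelled⁺ : ∀ {w φ} B → lab w φ ∈ B → (w , φ) ∈ labelled B
∈-labelled⁺ (_ ∷ B)       (here refl) = here refl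
∈-labelled⁺ (lab _ _ ∷ B) (there p)   = there (∈-labelled⁺ B p)
∈-labelled⁺ (eq _ _ ∷ B)  (there p)   = ∈-labelled⁺ B p
∈-labelled⁺ (neq _ _ ∷ B) (there p)   = ∈-labelled⁺ B p
∈-labelled⁺ (bot ∷ B)     (there p)   = ∈-labelled⁺ B p

∈-labels⁺ : ∀ {w φ} B → lab w φ ∈ B → w ∈ labels B
∈-labels⁺ B = ∈-map⁺ proj₁ ∘ ∈-labelled⁺ B

∈-equalities⁺ : ∀ {w v} B → eq w v ∈ B → (w , v) ∈ equalities B
∈-equalities⁺ (_ ∷ B)       (here refl) = here refl
∈-equalities⁺ (lab _ _ ∷ B) (there p)   = ∈-equalities⁺ B p
∈-equalities⁺ (eq _ _ ∷ B)  (there p)   = there (∈-equalities⁺ B p)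
∈-equalities⁺ (neq _ _ ∷ B) (there p)   = ∈-equalities⁺ B p
∈-equalities⁺ (bot ∷ B)     (there p)   = ∈-equalities⁺ B p

∈-equalities⁻ : ∀ {w v} B → (w , v) ∈ equalities B → eq w v ∈ B
∈-equalities⁻ (lab _ _ ∷ B) p           = there (∈-equalities⁻ B p)
∈-equalities⁻ (eq _ _ ∷ B)  (here refl) = here refl
∈-equalities⁻ (eq _ _ ∷ B)  (there p)   = there (∈-equalities⁻ B p)
∈-equalities⁻ (neq _ _ ∷ B) p           = there (∈-equalities⁻ B p)
∈-equalities⁻ (bot ∷ B)     p           = there (∈-equalities⁻ B p)

count⊥-∉ : ∀ B → bot ∉ B → count⊥ B ≡ 0
count⊥-∉ []            _  = refl
count⊥-∉ (lab _ _ ∷ B) ⊥∉ = count⊥-∉ B (⊥∉ ∘ there)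
count⊥-∉ (eq _ _ ∷ B)  ⊥∉ = count⊥-∉ B (⊥∉ ∘ there)
count⊥-∉ (neq _ _ ∷ B) ⊥∉ = count⊥-∉ B (⊥∉ ∘ there)
count⊥-∉ (bot ∷ B)     ⊥∉ = contradiction (here refl) ⊥∉

weight : List (Label × Fml) → ℕ
weight []            = 0
weight ((_ , ψ) ∷ P) = 2 * size ψ + weight P

weight-++ : ∀ P Q → weight (P ++ Q) ≡ weight P + weight Q
weight-++ []            Q = refl
weight-++ ((_ , ψ) ∷ P) Q =
  trans (cong (2 * size ψ +_) (weight-++ P Q)) (sym (+-assoc (2 * size ψ) (weight P) (weight Q)))

weight-─ : ∀ {w φ P} (p : (w , φ) ∈ P) → weight P ≡ 2 * size φ + weight (P ─ p)
weight-─ (here refl) = refl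
weight-─ {P = (_ , ψ) ∷ _} (there p) =
  trans (cong (2 * size ψ +_) (weight-─ p)) (x∙yz≈y∙xz (2 * size ψ) _ (weight (_ ─ p)))

data Side (v u : Label) : List Item → Set where
  none      : Side v u []
  same      : Side v u (eq v u ∷ [])
  different : Side v u (neq v u ∷ [])

data Conclusion : ℕ → List Label → List Item → Set where
  unary  : ∀ {v χ} → Conclusion (suc (size χ)) (v ∷ []) (lab v χ ∷ [])
  binary : ∀ {v u χ θ cs} → Side v u cs →
           Conclusion (suc (size χ + size θ)) (v ∷ u ∷ []) (lab v χ ∷ lab u θ ∷ cs)

conclusion : ∀ {w φ ls cs} → Dec w φ ls cs → Conclusion (size φ) ls cs
conclusion (¬⁺ _)    = unary
conclusion (¬⁻ _)    = unary
conclusion (⇒⁺₁ _ _) = binary none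
conclusion (⇒⁺₂ _ _) = binary none
conclusion (⇒⁺₃ _ _) = binary none
conclusion (⇒⁻ _ _)  = binary none
conclusion (≡⁺₁ _ _) = binary same
conclusion (≡⁺₂ _ _) = binary same
conclusion (≡⁻₁ _ _) = binary different
conclusion (≡⁻₂ _ _) = binary none
conclusion (≡⁻₃ _ _) = binary none
conclusion (≡⁻₄ _ _) = binary different

labelled-side : ∀ {v u cs} → Side v u cs → labelled cs ≡ []
labelled-side none      = refl
labelled-side same      = refl
labelled-side different = refl

conclusion-cost : ∀ {n ls cs} → Conclusion n ls cs →
  length (labelled cs) + weight (labelled cs) ≤ 2 * n
conclusion-cost (unary {χ = χ}) = ≤-trans (n≤1+n _) (≤-reflexive (unary-cost (size χ)))
  where
  unary-cost : ∀ a → suc (1 + (2 * a + 0)) ≡ 2 * suc a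
  unary-cost = solve-∀
conclusion-cost (binary {χ = χ} {θ} side) rewrite labelled-side side =
  ≤-reflexive (binary-cost (size χ) (size θ))
  where
  binary-cost : ∀ a b → 2 + (2 * a + (2 * b + 0)) ≡ 2 * suc (a + b)
  binary-cost = solve-∀

record Budget (n : ℕ) (L D : List (Label × Fml)) : Set where
  field
    pending          : List (Label × Fml)
    pending-complete : ∀ {p} → p ∈ L → p ∉ D → p ∈ pending
    within-budget    : length L + weight pending ≤ n

budget-root : ∀ w φ → Budget (suc (2 * size φ)) ((w , φ) ∷ []) []
budget-root w φ = record
  { pending          = (w , φ) ∷ []
  ; pending-complete = λ p _ → p
  ; within-budget    = s≤s (≤-reflexive (+-identityʳ (2 * size φ)))
  }

budget-decompose : ∀ {n L D w φ} N → Budget n L D → (w , φ) ∈ L → (w , φ) ∉ D →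
  length N + weight N ≤ 2 * size φ → Budget n (N ++ L) ((w , φ) ∷ D)
budget-decompose {n} {L} {D} {w} {φ} N budget wφ∈L wφ∉D cost = record
  { pending          = N ++ rest
  ; pending-complete = complete
  ; within-budget    = begin
      length (N ++ L) + weight (N ++ rest)
        ≡⟨ cong₂ _+_ (length-++ N) (weight-++ N rest) ⟩
      (length N + length L) + (weight N + weight rest)
        ≡⟨ interchange (length N) (length L) (weight N) (weight rest) ⟩
      (length N + weight N) + (length L + weight rest)
        ≤⟨ +-monoˡ-≤ (length L + weight rest) cost ⟩
      2 * size φ + (length L + weight rest)
        ≡⟨ x∙yz≈y∙xz (2 * size φ) (length L) (weight rest) ⟩
      length L + (2 * size φ + weight rest)
        ≡⟨ cong (length L +_) (weight-─ wφ∈pending) ⟨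
      length L + weight pending
        ≤⟨ within-budget ⟩
      n ∎
  }
  where
  open Budget budget
  open ≤-Reasoning
  wφ∈pending : (w , φ) ∈ pending
  wφ∈pending = pending-complete wφ∈L wφ∉D
  rest : List (Label × Fml)
  rest = pending ─ wφ∈pending
  complete : ∀ {p} → p ∈ N ++ L → p ∉ (w , φ) ∷ D → p ∈ N ++ rest
  complete p∈ p∉ with ∈-++⁻ N p∈
  ... | inj₁ p∈N = ∈-++⁺ˡ p∈N
  ... | inj₂ p∈L = ∈-++⁺ʳ N (∈-─ wφ∈pending (pending-complete p∈L (p∉ ∘ there)) (p∉ ∘ here))

labelled≤budget : ∀ {n L D} → Budget n L D → length L ≤ n
labelled≤budget {L = L} budget = m+n≤o⇒m≤o (length L) (Budget.within-budget budget)

record WellFormed (B : List Item) : Set where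
  field
    equalities-labelled : ∀ {w v} → (w , v) ∈ equalities B → w ∈ labels B × v ∈ labels B
    equalities-unique   : Unique (equalities B)
    count≠≤labelled     : count≠ B ≤ length (labelled B)
    count⊥≤1            : count⊥ B ≤ 1
open WellFormed

length≤labelled² : ∀ B → WellFormed B →
  length B ≤ suc (length (labelled B)) * suc (length (labelled B))
length≤labelled² B wf = begin
  length B                                   ≡⟨ length-by-kind B ⟩
  L + length (equalities B) + count≠ B + count⊥ B
    ≤⟨ +-mono-≤ (+-mono-≤ (+-monoʳ-≤ L equalities≤) (count≠≤labelled wf)) (count⊥≤1 wf) ⟩
  L + L * L + L + 1                          ≡⟨ square L ⟩
  suc L * suc L                              ∎
  where
  open ≤-Reasoning
  L = length (labelled B)
  square : ∀ a → a + a * a + a + 1 ≡ suc a * suc a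
  square = solve-∀
  equalities≤ : length (equalities B) ≤ L * L
  equalities≤ = begin
    length (equalities B)
      ≤⟨ unique∧⊆⇒length≤ (equalities-unique wf)
           (λ e∈ → let w∈ , v∈ = equalities-labelled wf e∈ in ∈-cartesianProduct⁺ w∈ v∈) ⟩
    length (cartesianProduct (labels B) (labels B))
      ≡⟨ length-cartesianProduct (labels B) (labels B) ⟩
    length (labels B) * length (labels B)
      ≡⟨ cong₂ _*_ (length-map proj₁ (labelled B)) (length-map proj₁ (labelled B)) ⟩
    L * L ∎

wellFormed-root : ∀ w φ → WellFormed (lab w φ ∷ [])
wellFormed-root w φ = record
  { equalities-labelled = λ ()
  ; equalities-unique   = []
  ; count≠≤labelled     = z≤n
  ; count⊥≤1            = z≤n
  }

wellFormed-lab : ∀ {w φ B} → WellFormed B → WellFormed (lab w φ ∷ B)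
wellFormed-lab wf = record
  { equalities-labelled = Product.map there there ∘ equalities-labelled wf
  ; equalities-unique   = equalities-unique wf
  ; count≠≤labelled     = m≤n⇒m≤1+n (count≠≤labelled wf)
  ; count⊥≤1            = count⊥≤1 wf
  }

wellFormed-eq : ∀ {w v B} → w ∈ labels B → v ∈ labels B → eq w v ∉ B →
  WellFormed B → WellFormed (eq w v ∷ B)
wellFormed-eq {B = B} w∈ v∈ eq∉ wf = record
  { equalities-labelled = λ { (here refl) → w∈ , v∈ ; (there e∈) → equalities-labelled wf e∈ }
  ; equalities-unique   = ¬Any⇒All¬ _ (eq∉ ∘ ∈-equalities⁻ B) ∷ equalities-unique wf
  ; count≠≤labelled     = count≠≤labelled wf
  ; count⊥≤1            = count⊥≤1 wf
  }

wellFormed-⊥ : ∀ {B} → bot ∉ B → WellFormed B → WellFormed (bot ∷ B)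
wellFormed-⊥ {B} ⊥∉ wf = record
  { equalities-labelled = equalities-labelled wf
  ; equalities-unique   = equalities-unique wf
  ; count≠≤labelled     = count≠≤labelled wf
  ; count⊥≤1            = s≤s (≤-reflexive (count⊥-∉ B ⊥∉))
  }

wellFormed-++ : ∀ {n ls cs B} → Conclusion n ls cs → All (FreshOn B) ls →
  WellFormed B → WellFormed (cs ++ B)
wellFormed-++ unary               _ = wellFormed-lab
wellFormed-++ (binary none)       _ = wellFormed-lab ∘ wellFormed-lab
wellFormed-++ {B = B} (binary same) (v-fresh ∷ _) wf = record
  { equalities-labelled = λ
      { (here refl) → here refl , there (here refl)
      ; (there e∈)  → Product.map (there ∘ there) (there ∘ there) (equalities-labelled wf e∈)
      }
  ; equalities-unique   =
      ¬Any⇒All¬ _ (λ e∈ → v-fresh (∈-equalities⁻ B e∈) in-eqˡ) ∷ equalities-unique wf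
  ; count≠≤labelled     = m≤n⇒m≤1+n (m≤n⇒m≤1+n (count≠≤labelled wf))
  ; count⊥≤1            = count⊥≤1 wf
  }
wellFormed-++ (binary different)  _ wf = record
  { equalities-labelled = Product.map (there ∘ there) (there ∘ there) ∘ equalities-labelled wf
  ; equalities-unique   = equalities-unique wf
  ; count≠≤labelled     = s≤s (m≤n⇒m≤1+n (count≠≤labelled wf))
  ; count⊥≤1            = count⊥≤1 wf
  }

data EqualityOfLabels (B : List Item) : Item → Set where
  equality : ∀ {w v} → w ∈ labels B → v ∈ labels B → EqualityOfLabels B (eq w v)

eqConcl-labels : ∀ {B c} → WellFormed B → EqConcl B c → EqualityOfLabels B c
eqConcl-labels {B} _  (r≡¬ _ p q)   = equality (∈-labels⁺ B p) (∈-labels⁺ B q)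
eqConcl-labels {B} _  (r≡⇒ _ _ p q) = equality (∈-labels⁺ B p) (∈-labels⁺ B q)
eqConcl-labels {B} _  (r≡≡ _ _ p q) = equality (∈-labels⁺ B p) (∈-labels⁺ B q)
eqConcl-labels {B} _  (rF p q)      = equality (∈-labels⁺ B p) (∈-labels⁺ B q)
eqConcl-labels {B} wf (rsym p)      =
  let w∈ , v∈ = equalities-labelled wf (∈-equalities⁺ B p) in equality v∈ w∈
eqConcl-labels {B} wf (rtran p q)   =
  equality (proj₁ (equalities-labelled wf (∈-equalities⁺ B p)))
           (proj₂ (equalities-labelled wf (∈-equalities⁺ B q)))

Invariant : ℕ → State → Set
Invariant n S = Budget n (labelled (State.items S)) (State.done S) × WellFormed (State.items S)

step-preserves : ∀ {n S S′} → Step S S′ → Invariant n S → Invariant n S′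
step-preserves {n} (decomp {B} {cs = cs} _ _ wφ∈B wφ∉D rule fresh _) (budget , wf) =
  subst (λ L → Budget n L _) (sym (labelled-++ cs B))
    (budget-decompose (labelled cs) budget (∈-labelled⁺ B wφ∈B) wφ∉D (conclusion-cost c))
  , wellFormed-++ c fresh wf
  where c = conclusion rule
step-preserves (equality _ _ rule c∉B) (budget , wf) with eqConcl-labels wf rule
... | equality w∈ v∈ = budget , wellFormed-eq w∈ v∈ c∉B wf
step-preserves (closure ⊥∉B _) (budget , wf) = budget , wellFormed-⊥ ⊥∉B wf

branch-invariant : ∀ {φ S} → Branch φ S → Invariant (suc (2 * size φ)) S
branch-invariant {φ} (root w)   = budget-root w φ , wellFormed-root w φ
branch-invariant (step branch s) = step-preserves s (branch-invariant branch)

corollary1 : Σ (List ℕ) λ p →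
    ∀ (φ : Fml) (S : State) → Branch φ S → branchSize S ≤ evalPoly p (size φ)
corollary1 = 4 ∷ 8 ∷ 4 ∷ [] , size-bound
  where
  size-bound : ∀ φ S → Branch φ S → branchSize S ≤ evalPoly (4 ∷ 8 ∷ 4 ∷ []) (size φ)
  size-bound φ ⟨ B , D ⟩ branch = begin
    length B                               ≤⟨ length≤labelled² B (proj₂ invariant) ⟩
    suc L * suc L                          ≤⟨ *-mono-≤ L<budget L<budget ⟩
    (2 + 2 * size φ) * (2 + 2 * size φ)    ≡⟨ square (size φ) ⟩
    evalPoly (4 ∷ 8 ∷ 4 ∷ []) (size φ)     ∎
    where
    open ≤-Reasoning
    invariant : Invariant (suc (2 * size φ)) ⟨ B , D ⟩
    invariant = branch-invariant branch
    L = length (labelled B)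
    L<budget : suc L ≤ 2 + 2 * size φ
    L<budget = s≤s (labelled≤budget (proj₁ invariant))
    square : ∀ n → (2 + 2 * n) * (2 + 2 * n) ≡ 4 + n * (8 + n * (4 + n * 0))
    square = solve-∀
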